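{- Let $T$ be a tree on $p$ vertices with $k$ pendant vertices and diameter $d$. Then $$W_\epsilon(T)\leq\frac{k\,\varepsilon^*(T)+dk(p-k-1)-k(p-k)}{2}.$$ Moreover, equality holds if $T\cong K_{1,p-1}$.
   Context: For a connected graph $T$ with vertices $v_1,\ldots,v_p$, $d(v_i,v_j)$ is the distance and $e(v_i)=\max_j d(v_i,v_j)$ the eccentricity. The eccentricity matrix $\epsilon(T)$ has $(i,j)$ entry $d(v_i,v_j)$ if $d(v_i,v_j)=\min\{e(v_i),e(v_j)\}$ and $0$ otherwise. $W_\epsilon(T)=\frac12\sum_{i,j}(\epsilon(T))_{ij}$ and $\varepsilon^*(T)=\sum_i e(v_i)$. A pendant vertex is a vertex of degree $1$. -}

module Defs where

open import Data.Nat using (ℕ; zero; suc; _+_; _*_; _≤_; _⊔_; _⊓_; _/_)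
open import Data.Nat.Properties using (_≟_)
open import Data.Bool using (Bool; true; false; _∨_; _∧_; if_then_else_)
open import Data.Fin using (Fin) renaming (_≟_ to _≟ᶠ_)
open import Data.List using (List; []; _∷_; map; allFin; filter; length; upTo; foldr; last)
open import Data.Bool.ListAction using (any)
open import Data.Nat.ListAction using (sum)
open import Data.Bool.Properties using () renaming (_≟_ to _≟ᵇ_)
open import Data.List.Relation.Unary.Unique.Propositional using (Unique)
open import Data.Product using (Σ; _×_; _,_)
open import Relation.Binary.PropositionalEquality using (_≡_; _≢_)
open import Relation.Nullary using (¬_; does)
open import Relation.Nullary.Decidable using (⌊_⌋)
open import Function.Bundles using (_↔_; Inverse)
open import Data.Maybe using (just)

record Graph (p : ℕ) : Set where
  field
    adj   : Fin p → Fin p → Bool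
    sym   : ∀ u v → adj u v ≡ adj v u
    irrefl : ∀ u → adj u u ≡ false
open Graph public

module _ {p : ℕ} (G : Graph p) where

  data Walk : Fin p → Fin p → Set where
    here : ∀ {u} → Walk u u
    step : ∀ {u w v} → adj G u w ≡ true → Walk w v → Walk u v

  Connected : Set
  Connected = ∀ u v → Walk u v

  Chain : List (Fin p) → Set
  Chain [] = Data.Unit.⊤ where import Data.Unit
  Chain (u ∷ []) = Data.Unit.⊤ where import Data.Unit
  Chain (u ∷ w ∷ vs) = (adj G u w ≡ true) × Chain (w ∷ vs)

  IsCycle : List (Fin p) → Set
  IsCycle [] = Data.Empty.⊥ where import Data.Empty
  IsCycle (v₀ ∷ vs) =
    (3 ≤ length (v₀ ∷ vs)) × Unique (v₀ ∷ vs) × Chain (v₀ ∷ vs) ×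
    Σ (Fin p) (λ vₘ → (last (v₀ ∷ vs) ≡ just vₘ) × (adj G vₘ v₀ ≡ true))

  Acyclic : Set
  Acyclic = ∀ (cs : List (Fin p)) → ¬ IsCycle cs

  IsTree : Set
  IsTree = Connected × Acyclic

  vertices : List (Fin p)
  vertices = allFin p

  reach : ℕ → Fin p → Fin p → Bool
  reach zero u v = ⌊ u ≟ᶠ v ⌋
  reach (suc n) u v = reach n u v ∨ any (λ w → reach n u w ∧ adj G w v) vertices

  -- distance: least n with reach n u v (counts n < p with reach n u v false);
  -- this is the usual distance d(u,v) when G is connected
  dist : Fin p → Fin p → ℕ
  dist u v = sum (map (λ n → if reach n u v then 0 else 1) (upTo p))

  maxList : List ℕ → ℕ
  maxList = foldr _⊔_ 0

  ecc : Fin p → ℕ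
  ecc u = maxList (map (dist u) vertices)

  diameter : ℕ
  diameter = maxList (map ecc vertices)

  degree : Fin p → ℕ
  degree u = length (filter (λ v → adj G u v ≟ᵇ true) vertices)

  pendantCount : ℕ
  pendantCount = length (filter (λ v → degree v ≟ 1) vertices)

  eccMatrix : Fin p → Fin p → ℕ
  eccMatrix u v = if does (dist u v ≟ (ecc u ⊓ ecc v)) then dist u v else 0

  Wε : ℕ
  Wε = sum (map (λ u → sum (map (eccMatrix u) vertices)) vertices) / 2

  totalEcc : ℕ
  totalEcc = sum (map ecc vertices)

star : (q : ℕ) → Graph (suc q)
star q = record { adj = a ; sym = s ; irrefl = i }
  where
  a : Fin (suc q) → Fin (suc q) → Bool
  a Fin.zero Fin.zero = false
  a Fin.zero (Fin.suc _) = true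
  a (Fin.suc _) Fin.zero = true
  a (Fin.suc _) (Fin.suc _) = false
  s : ∀ u v → a u v ≡ a v u
  s Fin.zero Fin.zero = Relation.Binary.PropositionalEquality.refl
  s Fin.zero (Fin.suc _) = Relation.Binary.PropositionalEquality.refl
  s (Fin.suc _) Fin.zero = Relation.Binary.PropositionalEquality.refl
  s (Fin.suc _) (Fin.suc _) = Relation.Binary.PropositionalEquality.refl
  i : ∀ u → a u u ≡ false
  i Fin.zero = Relation.Binary.PropositionalEquality.refl
  i (Fin.suc _) = Relation.Binary.PropositionalEquality.refl

Isomorphic : ∀ {p} → Graph p → Graph p → Set
Isomorphic {p} G H = Σ (Fin p ↔ Fin p) λ f →
  ∀ u v → adj H (Inverse.to f u) (Inverse.to f v) ≡ adj G u v

-- In a tree, a vertex at maximum distance from another vertex x is a leaf: a second neighbour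
-- no farther from x would close a cycle. Hence ε(u,w) = 0 unless u or w is a leaf, and since ε is
-- symmetric, Σ ε = Σ over leaves v of (Σ_{u leaf} ε(v,u) + 2 Σ_{u non-leaf} ε(v,u)). For a leaf v
-- every entry satisfies ε(v,u) ≤ e(u), and ε(v,u) ≤ d - 1 when u is not a leaf, so the row of v
-- costs at most ε* + (p-k)(d-1); a further d is saved at v itself when e(v) = d, and otherwise at
-- the neighbour of v, which is then a non-leaf with ε = 0. Summing over the k leaves bounds 2 W_ε.
-- For the star, K₁ and K₂ are evaluated, and a larger star has centre eccentricity 1 and rim
-- eccentricity 2, which determines every quantity.

module Submission where

open import Data.Product using (∃-syntax; _×_; _,_; proj₁; proj₂)
open import Relation.Binary.PropositionalEquality
open import Defs renaming (sym to adj-sym)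

-- ℕ arithmetic is opened only in this block, so that the statement at the end reads _+_, _*_, _≤_ on ℤ.
module _ where
  open import Data.Bool using (Bool; true; false; T; if_then_else_; _∨_; _∧_)
  open import Data.Bool.ListAction using (or)
  open import Data.Bool.Properties using (T-∨; T-∧; T-≡; if-eta) renaming (_≟_ to _≟ᵇ_)
  open import Data.Empty using (⊥-elim)
  open import Data.Fin using (Fin; zero; suc; toℕ) renaming (_≟_ to _≟ᶠ_)
  import Data.Fin.Properties as Fin
  open import Data.Fin.Properties using (toℕ-injective; injective⇒≤; toℕ≤pred[n])
  open import Data.List
    using (List; []; _∷_; _∷ʳ_; map; foldr; filter; length; last; applyUpTo; upTo; allFin; tabulate)
  open import Data.List.Properties
    using (map-applyUpTo; map-cong; map-tabulate; tabulate-cong; filter-≐; length-++; length-tabulate)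
  open import Function using (id; _∘_)
  open import Data.List.Membership.Propositional using (_∈_; lose)
  open import Data.List.Membership.Propositional.Properties using (∈-allFin; ∈-filter⁺; ∈-filter⁻)
  open import Data.List.Relation.Unary.All using (All; []; _∷_)
  import Data.List.Relation.Unary.All as All
  import Data.List.Relation.Unary.All.Properties as All
  open import Data.List.Relation.Unary.AllPairs using ([]; _∷_)
  open import Data.List.Relation.Unary.Any using (here; there; satisfied)
  open import Data.List.Relation.Unary.Any.Properties using (any⁺; any⁻)
  open import Data.List.Relation.Unary.Unique.Propositional using (Unique)
  import Data.List.Relation.Unary.Unique.Propositional.Properties as Unique
  open import Data.Maybe using (just)
  open import Data.Nat using (ℕ; zero; suc; _+_; _*_; _/_; _⊔_; _⊓_; _≤_; _<_; z≤n; s≤s; _≤?_; _≟_)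
  open import Data.Nat.DivMod using (m/n*n≤m; m*n/n≡m)
  open import Data.Nat.Induction using (<-rec)
  open import Data.Nat.ListAction using (sum)
  open import Data.Nat.Properties hiding (_≟_)
  open import Data.Nat.Tactic.RingSolver using (solve-∀)
  open import Data.Sum using (_⊎_; inj₁; inj₂)
  open import Data.Unit using (tt)
  open import Function.Bundles using (Equivalence; Inverse)
  open import Relation.Nullary using (¬_; Dec; yes; no; does; proof)
  open import Relation.Nullary.Decidable using (toWitness; fromWitness; map′; T?; dec-true; dec-false)
  open import Relation.Nullary.Negation using (contradiction)
  open import Relation.Nullary.Reflects using (Reflects; ofʸ; ofⁿ)
  open import Relation.Unary using (Decidable)
  open import Relation.Unary.Properties using (∁?)

  open import Algebra.Properties.CommutativeSemigroup +-commutativeSemigroup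
    using (interchange; xy∙z≈xz∙y; xy∙z≈x∙zy; x∙yz≈y∙xz; x∙yz≈xz∙y)

  count-false-prefix : ∀ N m (f : ℕ → Bool) → m ≤ N →
    (∀ n → n < m → f n ≡ false) → (∀ n → m ≤ n → f n ≡ true) →
    sum (applyUpTo (λ n → if f n then 0 else 1) N) ≡ m
  count-false-prefix zero .zero f z≤n _ _ = refl
  count-false-prefix (suc N) zero f _ _ true-after
    rewrite true-after 0 z≤n =
      count-false-prefix N 0 (λ n → f (suc n)) z≤n (λ _ ()) (λ n _ → true-after (suc n) z≤n)
  count-false-prefix (suc N) (suc m) f (s≤s m≤N) false-before true-after
    rewrite false-before 0 (s≤s z≤n) =
      cong suc (count-false-prefix N m (λ n → f (suc n)) m≤N (λ n n<m → false-before (suc n) (s≤s n<m))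
                                                           (λ n m≤n → true-after (suc n) (s≤s m≤n)))

  sum-map-+ : ∀ {A : Set} (f g : A → ℕ) xs →
    sum (map (λ x → f x + g x) xs) ≡ sum (map f xs) + sum (map g xs)
  sum-map-+ f g [] = refl
  sum-map-+ f g (x ∷ xs) = trans (cong (f x + g x +_) (sum-map-+ f g xs)) (interchange (f x) (g x) _ _)

  sum-map-mono : ∀ {A : Set} {f g : A → ℕ} xs → (∀ x → f x ≤ g x) → sum (map f xs) ≤ sum (map g xs)
  sum-map-mono [] _ = z≤n
  sum-map-mono (x ∷ xs) f≤g = +-mono-≤ (f≤g x) (sum-map-mono xs f≤g)

  sum-map-mono-slack : ∀ {A : Set} {f g : A → ℕ} {c y} xs →
    (∀ x → f x ≤ g x) → y ∈ xs → f y + c ≤ g y → sum (map f xs) + c ≤ sum (map g xs)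
  sum-map-mono-slack {f = f} {c = c} (x ∷ xs) f≤g (here refl) slack = begin
    f x + sum (map f xs) + c   ≡⟨ xy∙z≈xz∙y (f x) _ c ⟩
    f x + c + sum (map f xs)   ≤⟨ +-mono-≤ slack (sum-map-mono xs f≤g) ⟩
    _                          ∎
    where open ≤-Reasoning
  sum-map-mono-slack {f = f} {c = c} (x ∷ xs) f≤g (there y∈xs) slack = begin
    f x + sum (map f xs) + c   ≡⟨ +-assoc (f x) _ c ⟩
    f x + (sum (map f xs) + c) ≤⟨ +-mono-≤ (f≤g x) (sum-map-mono-slack xs f≤g y∈xs slack) ⟩
    _                          ∎
    where open ≤-Reasoning

  sum-map-const : ∀ {A : Set} c (xs : List A) → sum (map (λ _ → c) xs) ≡ length xs * c
  sum-map-const c [] = refl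
  sum-map-const c (x ∷ xs) = cong (c +_) (sum-map-const c xs)

  sum-map-swap : ∀ {A B : Set} (f : A → B → ℕ) xs ys →
    sum (map (λ x → sum (map (f x) ys)) xs) ≡ sum (map (λ y → sum (map (λ x → f x y) xs)) ys)
  sum-map-swap f [] ys = sym (trans (sum-map-const 0 ys) (*-zeroʳ (length ys)))
  sum-map-swap f (x ∷ xs) ys = trans (cong (_ +_) (sum-map-swap f xs ys)) (sym (sum-map-+ (f x) _ ys))

  length≡1⇒singleton : ∀ {A : Set} (xs : List A) → length xs ≡ 1 → ∃[ x ] xs ≡ x ∷ []
  length≡1⇒singleton (x ∷ []) _ = x , refl

  unique-constant⇒length≡1 : ∀ {A : Set} {w : A} {xs} → Unique xs → w ∈ xs → (∀ {y} → y ∈ xs → y ≡ w) →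
    length xs ≡ 1
  unique-constant⇒length≡1 {xs = _ ∷ []} _ _ _ = refl
  unique-constant⇒length≡1 {xs = x ∷ y ∷ _} ((x≢y ∷ _) ∷ _) _ ≡w =
    ⊥-elim (x≢y (trans (≡w (here refl)) (sym (≡w (there (here refl))))))

  unique-∷ʳ : ∀ {A : Set} {v : A} {xs} → Unique xs → (∀ {w} → w ∈ xs → w ≢ v) → Unique (xs ∷ʳ v)
  unique-∷ʳ unique ≢v = Unique.++⁺ unique ([] ∷ []) λ { (w∈xs , here refl) → ≢v w∈xs refl }

  module _ {A : Set} {P : A → Set} (P? : Decidable P) where

    length-filter-∁ : ∀ xs → length (filter P? xs) + length (filter (∁? P?) xs) ≡ length xs
    length-filter-∁ [] = refl
    length-filter-∁ (x ∷ xs) with does (P? x)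
    ... | true = cong suc (length-filter-∁ xs)
    ... | false = trans (+-suc _ _) (cong suc (length-filter-∁ xs))

    sum-map-if-then : ∀ c xs → sum (map (λ x → if does (P? x) then c else 0) xs) ≡ length (filter P? xs) * c
    sum-map-if-then c [] = refl
    sum-map-if-then c (x ∷ xs) with does (P? x)
    ... | true = cong (c +_) (sum-map-if-then c xs)
    ... | false = sum-map-if-then c xs

    sum-map-if-+ : ∀ (f g : A → ℕ) c xs →
      sum (map (λ x → if does (P? x) then f x else g x + c) xs)
        ≡ sum (map (λ x → if does (P? x) then f x else g x) xs) + length (filter (∁? P?) xs) * c
    sum-map-if-+ f g c [] = refl
    sum-map-if-+ f g c (x ∷ xs) with does (P? x)
    ... | true = trans (cong (f x +_) (sum-map-if-+ f g c xs)) (sym (+-assoc (f x) _ _))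
    ... | false = trans (cong (g x + c +_) (sum-map-if-+ f g c xs)) (interchange (g x) c _ _)

  ≤-max-map : ∀ {A : Set} (f : A → ℕ) {x xs} → x ∈ xs → f x ≤ foldr _⊔_ 0 (map f xs)
  ≤-max-map f (here refl) = m≤m⊔n _ _
  ≤-max-map f (there x∈xs) = ≤-trans (≤-max-map f x∈xs) (m≤n⊔m _ _)

  max-map-≤ : ∀ {A : Set} (f : A → ℕ) {b} xs → (∀ x → f x ≤ b) → foldr _⊔_ 0 (map f xs) ≤ b
  max-map-≤ f [] _ = z≤n
  max-map-≤ f (x ∷ xs) f≤b = ⊔-lub (f≤b x) (max-map-≤ f xs f≤b)

  max-map-attained : ∀ {A : Set} (f : A → ℕ) x xs → ∃[ y ] foldr _⊔_ 0 (map f (x ∷ xs)) ≡ f y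
  max-map-attained f x [] = x , ⊔-identityʳ (f x)
  max-map-attained f x (x′ ∷ xs) with ⊔-sel (f x) (foldr _⊔_ 0 (map f (x′ ∷ xs)))
  ... | inj₁ eq = x , eq
  ... | inj₂ eq = let (y , eq′) = max-map-attained f x′ xs in y , trans eq eq′

  max-allFin-attained : ∀ {n} (f : Fin n → ℕ) → Fin n → ∃[ i ] foldr _⊔_ 0 (map f (allFin n)) ≡ f i
  max-allFin-attained {suc n} f _ = max-map-attained f zero (tabulate suc)

  sum-tabulate-update : ∀ {n} {f g : Fin n → ℕ} c → (∀ {w} → w ≢ c → f w ≡ g w) →
    sum (tabulate f) + g c ≡ f c + sum (tabulate g)
  sum-tabulate-update {suc n} {f} {g} zero f≡g = begin
    f zero + sum (tabulate (f ∘ suc)) + g zero   ≡⟨ xy∙z≈x∙zy (f zero) _ (g zero) ⟩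
    f zero + (g zero + sum (tabulate (f ∘ suc))) ≡⟨ cong (λ s → f zero + (g zero + sum s))
                                                          (tabulate-cong (λ w → f≡g {suc w} λ ())) ⟩
    f zero + (g zero + sum (tabulate (g ∘ suc))) ∎
    where open ≡-Reasoning
  sum-tabulate-update {suc n} {f} {g} (suc c) f≡g = begin
    f zero + sum (tabulate (f ∘ suc)) + g (suc c)   ≡⟨ +-assoc (f zero) _ _ ⟩
    f zero + (sum (tabulate (f ∘ suc)) + g (suc c)) ≡⟨ cong (f zero +_)
                                                          (sum-tabulate-update c (λ w≢c → f≡g (w≢c ∘ Fin.suc-injective))) ⟩
    f zero + (f (suc c) + sum (tabulate (g ∘ suc))) ≡⟨ x∙yz≈y∙xz (f zero) (f (suc c)) _ ⟩
    f (suc c) + (f zero + sum (tabulate (g ∘ suc))) ≡⟨ cong (λ x → f (suc c) + (x + _)) (f≡g λ ()) ⟩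
    f (suc c) + (g zero + sum (tabulate (g ∘ suc))) ∎
    where open ≡-Reasoning

  sum-allFin-update : ∀ {n} {f g : Fin n → ℕ} c → (∀ {w} → w ≢ c → f w ≡ g w) →
    sum (map f (allFin n)) + g c ≡ f c + sum (map g (allFin n))
  sum-allFin-update {n} {f} {g} c f≡g =
    subst₂ (λ s t → sum s + g c ≡ f c + sum t) (sym (map-tabulate id f)) (sym (map-tabulate id g))
      (sum-tabulate-update c f≡g)

  sum-allFin-except : ∀ {n} {f : Fin (suc n) → ℕ} {a b} c → f c ≡ a → (∀ {w} → w ≢ c → f w ≡ b) →
    sum (map f (allFin (suc n))) ≡ a + n * b
  sum-allFin-except {n} {f} {a} {b} c fc≡a f≡b = +-cancelʳ-≡ b _ _ (begin
    sum (map f (allFin (suc n))) + b           ≡⟨ sum-allFin-update c f≡b ⟩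
    f c + sum (map (λ _ → b) (allFin (suc n))) ≡⟨ cong₂ _+_ fc≡a (sum-map-const b (allFin (suc n))) ⟩
    a + length (allFin (suc n)) * b            ≡⟨ cong (λ l → a + l * b) (length-tabulate {n = suc n} id) ⟩
    a + (b + n * b)                            ≡⟨ x∙yz≈xz∙y a b _ ⟩
    a + n * b + b                              ∎)
    where open ≡-Reasoning

  module Reachability {p : ℕ} (G : Graph p) where
    open Equivalence using (to; from)


    record Reach (n : ℕ) (u v : Fin p) : Set where
      constructor reaches
      field holds : T (reach G n u v)

    reach? : ∀ n u v → Dec (Reach n u v)
    reach? n u v = map′ reaches Reach.holds (T? (reach G n u v))

    reach-zero⁻ : ∀ {u v} → Reach 0 u v → u ≡ v
    reach-zero⁻ {u} {v} (reaches h) = toWitness {a? = u ≟ᶠ v} h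

    reach-refl : ∀ u → Reach 0 u u
    reach-refl u = reaches (fromWitness {a? = u ≟ᶠ u} refl)

    reach-suc : ∀ {n u v} → Reach n u v → Reach (suc n) u v
    reach-suc (reaches h) = reaches (from T-∨ (inj₁ h))

    reach-step : ∀ {n u w v} → Reach n u w → adj G w v ≡ true → Reach (suc n) u v
    reach-step {w = w} (reaches h) wv =
      reaches (from T-∨ (inj₂ (any⁺ _ (lose (∈-allFin w) (from T-∧ (h , from T-≡ wv))))))

    reach-suc⁻ : ∀ {n u v} → Reach (suc n) u v → Reach n u v ⊎ ∃[ w ] Reach n u w × adj G w v ≡ true
    reach-suc⁻ (reaches h) with to T-∨ h
    ... | inj₁ h′ = inj₁ (reaches h′)
    ... | inj₂ h′ with satisfied (any⁻ _ (vertices G) h′)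
    ...   | w , h″ = inj₂ (w , reaches (proj₁ (to T-∧ h″)) , to T-≡ (proj₂ (to T-∧ h″)))

    reach-mono : ∀ {m n u v} → m ≤ n → Reach m u v → Reach n u v
    reach-mono m≤n r with m≤n⇒m<n∨m≡n m≤n
    ... | inj₁ (s≤s m≤n′) = reach-suc (reach-mono m≤n′ r)
    ... | inj₂ refl = r

    reach-cons : ∀ {n u w v} → adj G u w ≡ true → Reach n w v → Reach (suc n) u v
    reach-cons {zero} {u} uw r rewrite reach-zero⁻ r = reach-step (reach-refl u) uw
    reach-cons {suc n} uw r with reach-suc⁻ r
    ... | inj₁ r′ = reach-suc (reach-cons uw r′)
    ... | inj₂ (x , r′ , xv) = reach-step (reach-cons uw r′) xv

    reach-sym : ∀ {n u v} → Reach n u v → Reach n v u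
    reach-sym {zero} r rewrite reach-zero⁻ r = reach-refl _
    reach-sym {suc n} r with reach-suc⁻ r
    ... | inj₁ r′ = reach-suc (reach-sym r′)
    ... | inj₂ (x , r′ , xv) = reach-cons (trans (adj-sym G _ x) xv) (reach-sym r′)

    reach-trans : ∀ {m n u v w} → Reach m u v → Reach n v w → Reach (m + n) u w
    reach-trans {m} {zero} r r′ rewrite reach-zero⁻ r′ | +-identityʳ m = r
    reach-trans {m} {suc n} r r′ rewrite +-suc m n with reach-suc⁻ r′
    ... | inj₁ r″ = reach-suc (reach-trans r r″)
    ... | inj₂ (x , r″ , xw) = reach-step (reach-trans r r″) xw

    walk⇒reach : ∀ {u v} → Walk G u v → ∃[ n ] Reach n u v
    walk⇒reach here = 0 , reach-refl _
    walk⇒reach (step uw w) = let (n , r) = walk⇒reach w in suc n , reach-cons uw r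

    Shortest : ℕ → Fin p → Fin p → Set
    Shortest n u v = Reach n u v × (∀ {m} → m < n → ¬ Reach m u v)

    shortest-exists : ∀ {n u v} → Reach n u v → ∃[ m ] Shortest m u v
    shortest-exists {zero} r = 0 , r , λ ()
    shortest-exists {suc n} {u} {v} r with reach? n u v
    ... | yes r′ = shortest-exists r′
    ... | no ¬r′ = suc n , r , λ m<1+n r′ → ¬r′ (reach-mono (≤-pred m<1+n) r′)

    shortest-unique : ∀ {m n u v} → Shortest m u v → Shortest n u v → m ≡ n
    shortest-unique (rm , min-m) (rn , min-n) =
      ≤-antisym (≮⇒≥ λ n<m → min-m n<m rn) (≮⇒≥ λ m<n → min-n m<n rm)

    shortest-pred : ∀ {n u v} → Shortest (suc n) u v → ∃[ w ] Shortest n u w × adj G w v ≡ true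
    shortest-pred {n} (r , min) with reach-suc⁻ r
    ... | inj₁ r′ = ⊥-elim (min (n<1+n n) r′)
    ... | inj₂ (w , rw , wv) = w , (rw , λ m<n rm → min (s≤s m<n) (reach-step rm wv)) , wv

    shortest-layer : ∀ {m k u v} → Shortest m u v → k ≤ m → ∃[ w ] Shortest k u w
    shortest-layer s k≤m with m≤n⇒m<n∨m≡n k≤m
    ... | inj₁ (s≤s k≤m′) = shortest-layer (proj₁ (proj₂ (shortest-pred s))) k≤m′
    ... | inj₂ refl = _ , s

    -- The layers 0, 1, …, m of a shortest walk of length m are m + 1 distinct vertices.
    shortest<p : ∀ {m u v} → Shortest m u v → m < p
    shortest<p {m} {u} s = injective⇒≤ {f = layer} layer-injective
      where
      layer : Fin (suc m) → Fin p
      layer k = proj₁ (shortest-layer s (toℕ≤pred[n] k))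

      layer-injective : ∀ {i j} → layer i ≡ layer j → i ≡ j
      layer-injective {i} {j} eq = toℕ-injective (shortest-unique
        (proj₂ (shortest-layer s (toℕ≤pred[n] i)))
        (subst (Shortest (toℕ j) u) (sym eq) (proj₂ (shortest-layer s (toℕ≤pred[n] j)))))

    dist-shortest : ∀ {m u v} → Shortest m u v → dist G u v ≡ m
    dist-shortest {m} {u} {v} s@(r , min) = trans
      (cong sum (map-applyUpTo (λ n → n) (λ n → if reach G n u v then 0 else 1) p))
      (count-false-prefix p m (λ n → reach G n u v) (<⇒≤ (shortest<p s))
        (λ n n<m → dec-false (T? (reach G n u v)) λ h → min n<m (reaches h))
        (λ n m≤n → to T-≡ (Reach.holds (reach-mono m≤n r))))

    dist-self : ∀ u → dist G u u ≡ 0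
    dist-self u = dist-shortest (reach-refl u , λ ())

    adj⇒≢ : ∀ {u v} → adj G u v ≡ true → u ≢ v
    adj⇒≢ {u} uv refl with () ← trans (sym uv) (irrefl G u)

    module Metric (connected : Connected G) where

      shortest-dist : ∀ u v → Shortest (dist G u v) u v
      shortest-dist u v with shortest-exists (proj₂ (walk⇒reach (connected u v)))
      ... | m , s = subst (λ k → Shortest k u v) (sym (dist-shortest s)) s

      reach-dist : ∀ u v → Reach (dist G u v) u v
      reach-dist u v = proj₁ (shortest-dist u v)

      dist-≤ : ∀ {m u v} → Reach m u v → dist G u v ≤ m
      dist-≤ {u = u} {v} r = ≮⇒≥ λ m<d → proj₂ (shortest-dist u v) m<d r

      dist≡0⇒≡ : ∀ {u v} → dist G u v ≡ 0 → u ≡ v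
      dist≡0⇒≡ {u} {v} d≡0 = reach-zero⁻ (subst (λ k → Reach k u v) d≡0 (reach-dist u v))

      ≢⇒dist≥1 : ∀ {u v} → u ≢ v → 1 ≤ dist G u v
      ≢⇒dist≥1 {u} {v} u≢v with dist G u v in eq
      ... | zero = ⊥-elim (u≢v (dist≡0⇒≡ eq))
      ... | suc _ = s≤s z≤n

      dist-sym : ∀ u v → dist G u v ≡ dist G v u
      dist-sym u v = ≤-antisym (dist-≤ (reach-sym (reach-dist v u))) (dist-≤ (reach-sym (reach-dist u v)))

      dist-triangle : ∀ u v w → dist G u w ≤ dist G u v + dist G v w
      dist-triangle u v w = dist-≤ (reach-trans (reach-dist u v) (reach-dist v w))

      adj⇒dist≡1 : ∀ {u v} → adj G u v ≡ true → dist G u v ≡ 1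
      adj⇒dist≡1 {u} uv = ≤-antisym (dist-≤ (reach-step (reach-refl u) uv)) (≢⇒dist≥1 (adj⇒≢ uv))

      dist-pred : ∀ {x v m} → dist G x v ≡ suc m → ∃[ a ] adj G a v ≡ true × dist G x a ≡ m
      dist-pred {x} {v} eq with shortest-pred (subst (λ k → Shortest k x v) eq (shortest-dist x v))
      ... | a , s , av = a , av , dist-shortest s

      dist≡1⇒adj : ∀ {u v} → dist G u v ≡ 1 → adj G u v ≡ true
      dist≡1⇒adj {u} d≡1 with dist-pred d≡1
      ... | a , av , d≡0 rewrite dist≡0⇒≡ d≡0 = av

      dist-layer : ∀ {x v k} → k ≤ dist G x v → ∃[ w ] dist G x w ≡ k
      dist-layer {x} {v} k≤d with shortest-layer (shortest-dist x v) k≤d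
      ... | w , s = w , dist-shortest s

      dist≤ecc : ∀ u w → dist G u w ≤ ecc G u
      dist≤ecc u w = ≤-max-map (dist G u) (∈-allFin w)

      ecc-≤ : ∀ {b} u → (∀ w → dist G u w ≤ b) → ecc G u ≤ b
      ecc-≤ u = max-map-≤ (dist G u) (allFin p)

      ecc-attained : ∀ u → ∃[ w ] dist G u w ≡ ecc G u
      ecc-attained u = let (w , eq) = max-allFin-attained (dist G u) u in w , sym eq

      ecc≤diameter : ∀ u → ecc G u ≤ diameter G
      ecc≤diameter u = ≤-max-map (ecc G) (∈-allFin u)

      diameter-≤ : ∀ {b} → (∀ u w → dist G u w ≤ b) → diameter G ≤ b
      diameter-≤ d≤b = max-map-≤ (ecc G) (allFin p) (λ u → ecc-≤ u (d≤b u))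

  module Leaves {p : ℕ} (G : Graph p) where

    Leaf : Fin p → Set
    Leaf v = degree G v ≡ 1

    leaf? : ∀ v → Dec (Leaf v)
    leaf? v = degree G v ≟ 1

    ℓ : Fin p → Bool
    ℓ u = does (leaf? u)

    innerCount : ℕ
    innerCount = length (filter (∁? leaf?) (vertices G))

    leafCount+innerCount≡p : pendantCount G + innerCount ≡ p
    leafCount+innerCount≡p = trans (length-filter-∁ leaf? (vertices G)) (length-tabulate (λ v → v))

    neighbours : Fin p → List (Fin p)
    neighbours v = filter (λ w → adj G v w ≟ᵇ true) (vertices G)

    ∈-neighbours⁺ : ∀ {v w} → adj G v w ≡ true → w ∈ neighbours v
    ∈-neighbours⁺ {v} {w} vw = ∈-filter⁺ (λ w → adj G v w ≟ᵇ true) (∈-allFin w) vw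

    leaf-neighbour : ∀ {v} → Leaf v → ∃[ w ] adj G v w ≡ true
    leaf-neighbour {v} leaf with length≡1⇒singleton (neighbours v) leaf
    ... | w , eq =
      w , proj₂ (∈-filter⁻ (λ w → adj G v w ≟ᵇ true) {xs = allFin p} (subst (w ∈_) (sym eq) (here refl)))

    leaf-neighbour-unique : ∀ {v a b} → Leaf v → adj G v a ≡ true → adj G v b ≡ true → a ≡ b
    leaf-neighbour-unique {v} leaf va vb with length≡1⇒singleton (neighbours v) leaf
    ... | w , eq with subst (_ ∈_) eq (∈-neighbours⁺ va) | subst (_ ∈_) eq (∈-neighbours⁺ vb)
    ...   | here refl | here refl = refl

    unique-neighbour⇒leaf : ∀ {v w} → adj G v w ≡ true → (∀ {y} → adj G v y ≡ true → y ≡ w) → Leaf v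
    unique-neighbour⇒leaf {v} vw only-w =
      unique-constant⇒length≡1 (Unique.filter⁺ (λ w → adj G v w ≟ᵇ true) (Unique.allFin⁺ p))
        (∈-neighbours⁺ vw)
        (λ y∈ → only-w (proj₂ (∈-filter⁻ (λ w → adj G v w ≟ᵇ true) {xs = allFin p} y∈)))

  module Tree {p : ℕ} (G : Graph p) (tree : IsTree G) where
    open Reachability G
    open Metric (proj₁ tree)
    open Leaves G

    data Path : Fin p → Fin p → List (Fin p) → Set where
      trivial : ∀ {a} → Path a a (a ∷ [])
      _◅_ : ∀ {a a′ b xs} → adj G a a′ ≡ true → Path a′ b xs → Path a b (a ∷ xs)

    _▻_ : ∀ {a b c xs} → Path a b xs → adj G b c ≡ true → Path a c (xs ∷ʳ c)
    trivial ▻ bc = bc ◅ trivial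
    (aa′ ◅ P) ▻ bc = aa′ ◅ (P ▻ bc)

    path-chain : ∀ {a b xs} → Path a b xs → Chain G xs
    path-chain trivial = tt
    path-chain (aa′ ◅ trivial) = aa′ , tt
    path-chain (aa′ ◅ P@(_ ◅ _)) = aa′ , path-chain P

    path-last : ∀ {a b xs} → Path a b xs → last xs ≡ just b
    path-last trivial = refl
    path-last (_ ◅ trivial) = refl
    path-last (_ ◅ P@(_ ◅ _)) = path-last P

    path-length : ∀ {a b xs} → Path a b xs → a ≢ b → 2 ≤ length xs
    path-length trivial a≢a = ⊥-elim (a≢a refl)
    path-length (_ ◅ trivial) _ = s≤s (s≤s z≤n)
    path-length (_ ◅ (_ ◅ _)) _ = s≤s (s≤s z≤n)

    path⇒cycle : ∀ {a b xs} → Path a b xs → Unique xs → 3 ≤ length xs → adj G b a ≡ true → IsCycle G xs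
    path⇒cycle trivial _ (s≤s ()) _
    path⇒cycle {b = b} P@(_ ◅ _) unique long ba = long , unique , path-chain P , b , path-last P , ba

    module Rooted (x : Fin p) where

      private
        d : Fin p → ℕ
        d = dist G x

      Inner : Fin p → Fin p → Fin p → Set
      Inner a b w = w ≡ a ⊎ w ≡ b ⊎ d w < d a ⊔ d b

      SimplePath : Fin p → Fin p → Set
      SimplePath a b = ∃[ xs ] Path a b xs × Unique xs × All (Inner a b) xs

      <⇒≢ᵈ : ∀ {v w} → d v < d w → v ≢ w
      <⇒≢ᵈ d<d refl = <-irrefl refl d<d

      extendˡ : ∀ {a a′ b} → adj G a′ a ≡ true → d a′ < d a → d b ≤ d a → a ≢ b →
        SimplePath a′ b → SimplePath a b
      extendˡ {a} {a′} {b} a′a a′<a b≤a a≢b (ys , P , unique , inner) =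
        a ∷ ys , trans (adj-sym G a a′) a′a ◅ P , All.map a≢ inner ∷ unique , inj₁ refl ∷ All.map widen inner
        where
        a′⊔b≤a : d a′ ⊔ d b ≤ d a
        a′⊔b≤a = ⊔-lub (<⇒≤ a′<a) b≤a
        a≢ : ∀ {w} → Inner a′ b w → a ≢ w
        a≢ (inj₁ refl) = ≢-sym (<⇒≢ᵈ a′<a)
        a≢ (inj₂ (inj₁ refl)) = a≢b
        a≢ (inj₂ (inj₂ w<)) = ≢-sym (<⇒≢ᵈ (<-≤-trans w< a′⊔b≤a))
        widen : ∀ {w} → Inner a′ b w → Inner a b w
        widen (inj₁ refl) = inj₂ (inj₂ (<-≤-trans a′<a (m≤m⊔n _ _)))
        widen (inj₂ (inj₁ refl)) = inj₂ (inj₁ refl)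
        widen (inj₂ (inj₂ w<)) = inj₂ (inj₂ (<-≤-trans w< (⊔-monoˡ-≤ (d b) (<⇒≤ a′<a))))

      extendʳ : ∀ {a b b′} → adj G b′ b ≡ true → d b′ < d b → d a ≤ d b → a ≢ b →
        SimplePath a b′ → SimplePath a b
      extendʳ {a} {b} {b′} b′b b′<b a≤b a≢b (ys , P , unique , inner) =
        ys ∷ʳ b , P ▻ b′b , unique-∷ʳ unique (≢b ∘ All.lookup inner) ,
        All.∷ʳ⁺ (All.map widen inner) (inj₂ (inj₁ refl))
        where
        a⊔b′≤b : d a ⊔ d b′ ≤ d b
        a⊔b′≤b = ⊔-lub a≤b (<⇒≤ b′<b)
        ≢b : ∀ {w} → Inner a b′ w → w ≢ b
        ≢b (inj₁ refl) = a≢b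
        ≢b (inj₂ (inj₁ refl)) = <⇒≢ᵈ b′<b
        ≢b (inj₂ (inj₂ w<)) = <⇒≢ᵈ (<-≤-trans w< a⊔b′≤b)
        widen : ∀ {w} → Inner a b′ w → Inner a b w
        widen (inj₁ refl) = inj₁ refl
        widen (inj₂ (inj₁ refl)) = inj₂ (inj₂ (<-≤-trans b′<b (m≤n⊔m _ _)))
        widen (inj₂ (inj₂ w<)) = inj₂ (inj₂ (<-≤-trans w< (⊔-monoʳ-≤ (d a) (<⇒≤ b′<b))))

      closer-neighbour : ∀ {a b} → a ≢ b → d b ≤ d a → ∃[ a′ ] adj G a′ a ≡ true × d a′ < d a
      closer-neighbour {a} {b} a≢b b≤a with d a in da
      ... | zero = ⊥-elim (a≢b (trans (sym (dist≡0⇒≡ da)) (dist≡0⇒≡ (n≤0⇒n≡0 b≤a))))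
      ... | suc m = let (a′ , a′a , da′) = dist-pred da in a′ , a′a , ≤-reflexive (cong suc da′)

      simple-path : ∀ a b → SimplePath a b
      simple-path a b = <-rec (λ s → ∀ a b → d a + d b ≡ s → SimplePath a b) shorten _ a b refl
        where
        shorten : ∀ s → (∀ {t} → t < s → ∀ a b → d a + d b ≡ t → SimplePath a b) →
                  ∀ a b → d a + d b ≡ s → SimplePath a b
        shorten _ rec a b refl with a ≟ᶠ b
        ... | yes refl = a ∷ [] , trivial , [] ∷ [] , inj₁ refl ∷ []
        ... | no a≢b with d b ≤? d a
        ...   | yes b≤a = let (a′ , a′a , a′<a) = closer-neighbour a≢b b≤a in
                  extendˡ a′a a′<a b≤a a≢b (rec (+-monoˡ-< (d b) a′<a) a′ b refl)
        ...   | no b≰a = let a<b = ≰⇒> b≰a ; (b′ , b′b , b′<b) = closer-neighbour (≢-sym a≢b) (<⇒≤ a<b) in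
                  extendʳ b′b b′<b (<⇒≤ a<b) a≢b (rec (+-monoʳ-< (d a) b′<b) a b′ refl)

      upward-neighbour-unique : ∀ {v a b} → adj G v a ≡ true → adj G v b ≡ true →
        d a ≤ d v → d b ≤ d v → a ≡ b
      upward-neighbour-unique {v} {a} {b} va vb a≤v b≤v with a ≟ᶠ b
      ... | yes a≡b = a≡b
      ... | no a≢b with simple-path a b
      ...   | ys , P , unique , inner = ⊥-elim (proj₂ tree (ys ∷ʳ v) (path⇒cycle (P ▻ trans (adj-sym G b v) vb)
                (unique-∷ʳ unique (≢v ∘ All.lookup inner))
                (subst (3 ≤_) (sym (length-++ ys)) (+-monoˡ-≤ 1 (path-length P a≢b)))
                va))
        where
        ≢v : ∀ {w} → Inner a b w → w ≢ v
        ≢v (inj₁ refl) = ≢-sym (adj⇒≢ va)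
        ≢v (inj₂ (inj₁ refl)) = ≢-sym (adj⇒≢ vb)
        ≢v (inj₂ (inj₂ w<)) = <⇒≢ᵈ (<-≤-trans w< (⊔-lub a≤v b≤v))

      farthest⇒leaf : ∀ {v} → x ≢ v → d v ≡ ecc G x → Leaf v
      farthest⇒leaf {v} x≢v far with closer-neighbour (≢-sym x≢v) (subst (_≤ d v) (sym (dist-self x)) z≤n)
      ... | a , av , a<v = unique-neighbour⇒leaf va
            (λ vy → upward-neighbour-unique vy va (subst (_ ≤_) (sym far) (dist≤ecc x _)) (<⇒≤ a<v))
        where
        va : adj G v a ≡ true
        va = trans (adj-sym G v a) av

  module EccentricityMatrix {p : ℕ} (G : Graph p) (tree : IsTree G) where
    open Reachability G
    open Metric (proj₁ tree)
    open Leaves G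
    open Tree G tree

    private
      ε : Fin p → Fin p → ℕ
      ε = eccMatrix G

    eccMatrix-≡dist : ∀ {u w} → dist G u w ≡ ecc G u ⊓ ecc G w → ε u w ≡ dist G u w
    eccMatrix-≡dist {u} {w} eq =
      cong (λ b → if b then dist G u w else 0) (dec-true (dist G u w ≟ ecc G u ⊓ ecc G w) eq)

    eccMatrix-cases : ∀ u w → ε u w ≡ 0 ⊎ (ε u w ≡ dist G u w × dist G u w ≡ ecc G u ⊓ ecc G w)
    eccMatrix-cases u w with dist G u w ≟ ecc G u ⊓ ecc G w
    ... | yes eq = inj₂ (eccMatrix-≡dist eq , eq)
    ... | no ne =
      inj₁ (cong (λ b → if b then dist G u w else 0) (dec-false (dist G u w ≟ ecc G u ⊓ ecc G w) ne))

    eccMatrix-sym : ∀ u w → ε u w ≡ ε w u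
    eccMatrix-sym u w =
      cong₂ (λ δ m → if does (δ ≟ m) then δ else 0) (dist-sym u w) (⊓-comm (ecc G u) (ecc G w))

    eccMatrix≤dist : ∀ u w → ε u w ≤ dist G u w
    eccMatrix≤dist u w with eccMatrix-cases u w
    ... | inj₁ ≡0 = ≤-trans (≤-reflexive ≡0) z≤n
    ... | inj₂ (≡dist , _) = ≤-reflexive ≡dist

    eccMatrix-self : ∀ u → ε u u ≡ 0
    eccMatrix-self u = n≤0⇒n≡0 (subst (ε u u ≤_) (dist-self u) (eccMatrix≤dist u u))

    eccMatrix≤ecc : ∀ u w → ε u w ≤ ecc G w
    eccMatrix≤ecc u w with eccMatrix-cases u w
    ... | inj₁ ≡0 = ≤-trans (≤-reflexive ≡0) z≤n
    ... | inj₂ (≡dist , ≡min) = ≤-trans (≤-reflexive (trans ≡dist ≡min)) (m⊓n≤n _ _)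

    eccMatrix-inner : ∀ {u w} → ¬ Leaf u → ¬ Leaf w → ε u w ≡ 0
    eccMatrix-inner {u} {w} inner-u inner-w with eccMatrix-cases u w
    ... | inj₁ ≡0 = ≡0
    ... | inj₂ (≡dist , ≡min) with u ≟ᶠ w | ≤-total (ecc G u) (ecc G w)
    ...   | yes refl | _ = eccMatrix-self u
    ...   | no u≢w | inj₁ u≤w =
      ⊥-elim (inner-w (Rooted.farthest⇒leaf u u≢w (trans ≡min (m≤n⇒m⊓n≡m u≤w))))
    ...   | no u≢w | inj₂ w≤u =
      ⊥-elim (inner-u (Rooted.farthest⇒leaf w (≢-sym u≢w) (trans (dist-sym w u) (trans ≡min (m≥n⇒m⊓n≡n w≤u)))))

    weighted : Fin p → Bool → Fin p → ℕ
    weighted v b u = if b then ε v u else ε v u + ε v u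

    module LeafRow {v} (leaf : Leaf v) where

      private
        d : ℕ
        d = diameter G

      u₀ : Fin p
      u₀ = proj₁ (leaf-neighbour leaf)

      vu₀ : adj G v u₀ ≡ true
      vu₀ = proj₂ (leaf-neighbour leaf)

      dist-v-u₀ : dist G v u₀ ≡ 1
      dist-v-u₀ = adj⇒dist≡1 vu₀

      1≤ecc : 1 ≤ ecc G v
      1≤ecc = subst (_≤ ecc G v) dist-v-u₀ (dist≤ecc v u₀)

      eccMatrix<diameter : ∀ {u} → ¬ Leaf u → ε v u < d
      eccMatrix<diameter {u} inner with eccMatrix-cases v u
      ... | inj₁ ≡0 = subst (_< d) (sym ≡0) (≤-trans 1≤ecc (ecc≤diameter v))
      ... | inj₂ (≡dist , _) = subst (_< d) (sym ≡dist) (≤∧≢⇒< (≤-trans (dist≤ecc v u) (ecc≤diameter v)) ≢d)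
        where
        ≢d : dist G v u ≢ d
        ≢d ≡d = inner (Rooted.farthest⇒leaf v v≢u
                         (≤-antisym (dist≤ecc v u) (subst (ecc G v ≤_) (sym ≡d) (ecc≤diameter v))))
          where
          v≢u : v ≢ u
          v≢u refl with () ← ≤-trans (≤-trans 1≤ecc (ecc≤diameter v)) (≤-reflexive (trans (sym ≡d) (dist-self v)))

      module NonPeripheral (ecc<d : ecc G v < d) where

        2≤ecc : 2 ≤ ecc G v
        2≤ecc with 2 ≤? ecc G v
        ... | yes 2≤ = 2≤
        ... | no 2≰ = ⊥-elim (<-irrefl refl (<-≤-trans ecc<d (≤-trans d≤1 1≤ecc)))
          where
          ecc≤1 : ecc G v ≤ 1
          ecc≤1 = ≤-pred (≰⇒> 2≰)
          near : ∀ w → w ≡ v ⊎ w ≡ u₀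
          near w with dist G v w in eq
          ... | 0 = inj₁ (sym (dist≡0⇒≡ eq))
          ... | 1 = inj₂ (leaf-neighbour-unique leaf (dist≡1⇒adj eq) vu₀)
          ... | suc (suc _) with s≤s () ← ≤-trans (≤-trans (≤-reflexive (sym eq)) (dist≤ecc v w)) ecc≤1
          close : ∀ {y z} → y ≡ v ⊎ y ≡ u₀ → z ≡ v ⊎ z ≡ u₀ → dist G y z ≤ 1
          close (inj₁ refl) (inj₁ refl) = ≤-trans (≤-reflexive (dist-self v)) z≤n
          close (inj₁ refl) (inj₂ refl) = ≤-reflexive dist-v-u₀
          close (inj₂ refl) (inj₁ refl) = ≤-reflexive (trans (dist-sym u₀ v) dist-v-u₀)
          close (inj₂ refl) (inj₂ refl) = ≤-trans (≤-reflexive (dist-self u₀)) z≤n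
          d≤1 : d ≤ 1
          d≤1 = diameter-≤ λ y z → close (near y) (near z)

        u₀-inner : ¬ Leaf u₀
        u₀-inner leaf-u₀ = v≢w₂ (leaf-neighbour-unique leaf-u₀ (trans (adj-sym G u₀ v) vu₀) u₀w₂)
          where
          w₂-at-2 : ∃[ w₂ ] dist G v w₂ ≡ 2
          w₂-at-2 = dist-layer (subst (2 ≤_) (sym (proj₂ (ecc-attained v))) 2≤ecc)
          w₂ : Fin p
          w₂ = proj₁ w₂-at-2
          parent : ∃[ a ] adj G a w₂ ≡ true × dist G v a ≡ 1
          parent = dist-pred (proj₂ w₂-at-2)
          u₀w₂ : adj G u₀ w₂ ≡ true
          u₀w₂ = subst (λ a → adj G a w₂ ≡ true)
            (leaf-neighbour-unique leaf (dist≡1⇒adj (proj₂ (proj₂ parent))) vu₀) (proj₁ (proj₂ parent))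
          v≢w₂ : v ≢ w₂
          v≢w₂ v≡w₂ with () ← trans (sym (dist-self v)) (trans (cong (dist G v) v≡w₂) (proj₂ w₂-at-2))

        eccMatrix-v-u₀ : ε v u₀ ≡ 0
        eccMatrix-v-u₀ with eccMatrix-cases v u₀
        ... | inj₁ ≡0 = ≡0
        ... | inj₂ (_ , ≡min) with ⊓-sel (ecc G v) (ecc G u₀)
        ...   | inj₁ ≡ecc-v
          with s≤s () ← ≤-trans 2≤ecc (≤-reflexive (trans (sym ≡ecc-v) (trans (sym ≡min) dist-v-u₀)))
        ...   | inj₂ ≡ecc-u₀ = ⊥-elim (<-irrefl refl (<-≤-trans ecc<d (≤-trans d≤2 2≤ecc)))
          where
          ecc-u₀ : ecc G u₀ ≡ 1
          ecc-u₀ = trans (sym ≡ecc-u₀) (trans (sym ≡min) dist-v-u₀)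
          d≤2 : d ≤ 2
          d≤2 = diameter-≤ λ y z → ≤-trans (dist-triangle y u₀ z)
            (+-mono-≤ (≤-trans (≤-reflexive (dist-sym y u₀)) (subst (dist G u₀ y ≤_) ecc-u₀ (dist≤ecc u₀ y)))
                      (subst (dist G u₀ z ≤_) ecc-u₀ (dist≤ecc u₀ z)))

      cost : Bool → Fin p → ℕ
      cost b u = if b then ε v u else ε v u + ε v u + 1

      budget : Bool → Fin p → ℕ
      budget b u = if b then ecc G u else ecc G u + d

      cost≤budget : ∀ {u b} → Reflects (Leaf u) b → cost b u ≤ budget b u
      cost≤budget {u} (ofʸ _) = eccMatrix≤ecc v u
      cost≤budget {u} (ofⁿ inner) = begin
        ε v u + ε v u + 1   ≡⟨ +-assoc (ε v u) _ 1 ⟩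
        ε v u + (ε v u + 1) ≤⟨ +-mono-≤ (eccMatrix≤ecc v u)
                                         (subst (_≤ d) (+-comm 1 (ε v u)) (eccMatrix<diameter inner)) ⟩
        ecc G u + d         ∎
        where open ≤-Reasoning

      slack : ∃[ u ] cost (ℓ u) u + d ≤ budget (ℓ u) u
      slack with d ≤? ecc G v
      ... | yes d≤ecc = v , at-v (proof (leaf? v))
        where
        at-v : ∀ {b} → Reflects (Leaf v) b → cost b v + d ≤ budget b v
        at-v (ofʸ _) = subst (λ x → x + d ≤ ecc G v) (sym (eccMatrix-self v)) d≤ecc
        at-v (ofⁿ inner) = ⊥-elim (inner leaf)
      ... | no d≰ecc = u₀ , at-u₀ (proof (leaf? u₀))
        where
        open NonPeripheral (≰⇒> d≰ecc)
        at-u₀ : ∀ {b} → Reflects (Leaf u₀) b → cost b u₀ + d ≤ budget b u₀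
        at-u₀ (ofʸ leaf-u₀) = ⊥-elim (u₀-inner leaf-u₀)
        at-u₀ (ofⁿ _) = subst (λ x → x + x + 1 + d ≤ ecc G u₀ + d) (sym eccMatrix-v-u₀)
          (+-monoˡ-≤ d (subst (_≤ ecc G u₀) (trans (dist-sym u₀ v) dist-v-u₀) (dist≤ecc u₀ v)))

      row-bound : sum (map (λ u → weighted v (ℓ u) u) (vertices G)) + innerCount + d
                    ≤ totalEcc G + innerCount * d
      row-bound = begin
        sum (map (λ u → weighted v (ℓ u) u) V) + innerCount + d
          ≡⟨ cong (λ n → sum (map (λ u → weighted v (ℓ u) u) V) + n + d) (sym (*-identityʳ innerCount)) ⟩
        sum (map (λ u → weighted v (ℓ u) u) V) + innerCount * 1 + d
          ≡⟨ cong (_+ d) (sym (sum-map-if-+ leaf? (ε v) (λ u → ε v u + ε v u) 1 V)) ⟩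
        sum (map (λ u → cost (ℓ u) u) V) + d
          ≤⟨ sum-map-mono-slack V (λ u → cost≤budget (proof (leaf? u))) (∈-allFin _) (proj₂ slack) ⟩
        sum (map (λ u → budget (ℓ u) u) V)
          ≡⟨ sum-map-if-+ leaf? (ecc G) (ecc G) d V ⟩
        sum (map (λ u → if ℓ u then ecc G u else ecc G u) V) + innerCount * d
          ≡⟨ cong (λ e → sum e + innerCount * d) (map-cong (λ u → if-eta (ℓ u)) V) ⟩
        totalEcc G + innerCount * d ∎
        where
        open ≤-Reasoning
        V : List (Fin p)
        V = vertices G

    private
      total : (Fin p → Fin p → ℕ) → ℕ
      total f = sum (map (λ v → sum (map (f v) (vertices G))) (vertices G))

      total-+ : ∀ f g → total (λ v u → f v u + g v u) ≡ total f + total g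
      total-+ f g = trans (cong sum (map-cong (λ v → sum-map-+ (f v) (g v) V) V)) (sum-map-+ _ _ V)
        where
        V : List (Fin p)
        V = vertices G

    weightedMatrix : Fin p → Fin p → ℕ
    weightedMatrix v u = if ℓ v then weighted v (ℓ u) u else 0

    symmetrised : ∀ {v u a b} → Reflects (Leaf v) a → Reflects (Leaf u) b →
      ε v u + ε u v ≡ (if a then weighted v b u else 0) + (if b then weighted u a v else 0)
    symmetrised (ofʸ _) (ofʸ _) = refl
    symmetrised {v} {u} (ofʸ _) (ofⁿ _) = trans (cong (ε v u +_) (eccMatrix-sym u v)) (sym (+-identityʳ _))
    symmetrised {v} {u} (ofⁿ _) (ofʸ _) = cong (_+ ε u v) (eccMatrix-sym v u)
    symmetrised (ofⁿ inner-v) (ofⁿ inner-u) =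
      cong₂ _+_ (eccMatrix-inner inner-v inner-u) (eccMatrix-inner inner-u inner-v)

    eccMatrix-total : total ε ≡ total weightedMatrix
    eccMatrix-total = *-cancelˡ-≡ _ _ 2 (begin
      2 * total ε                         ≡⟨ cong (total ε +_) (+-identityʳ (total ε)) ⟩
      total ε + total ε                   ≡⟨ cong (total ε +_) (sum-map-swap ε V V) ⟩
      total ε + total (λ v u → ε u v)     ≡⟨ total-+ ε (λ v u → ε u v) ⟨
      total (λ v u → ε v u + ε u v)       ≡⟨ cong sum (map-cong (λ v → cong sum (map-cong (λ u →
                                               symmetrised (proof (leaf? v)) (proof (leaf? u))) V)) V) ⟩
      total (λ v u → W v u + W u v)       ≡⟨ total-+ W (λ v u → W u v) ⟩
      total W + total (λ v u → W u v)     ≡⟨ cong (total W +_) (sum-map-swap W V V) ⟨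
      total W + total W                   ≡⟨ cong (total W +_) (+-identityʳ _) ⟨
      2 * total W                         ∎)
      where
      open ≡-Reasoning
      V : List (Fin p)
      V = vertices G
      W : Fin p → Fin p → ℕ
      W = weightedMatrix

    weightedMatrix-row-bound : ∀ {v a} → Reflects (Leaf v) a →
      sum (map (λ u → if a then weighted v (ℓ u) u else 0) (vertices G))
        + (if a then innerCount + diameter G else 0)
        ≤ (if a then totalEcc G + innerCount * diameter G else 0)
    weightedMatrix-row-bound {v} (ofʸ leaf) =
      ≤-trans (≤-reflexive (sym (+-assoc (sum (map (λ u → weighted v (ℓ u) u) (vertices G))) innerCount (diameter G))))
              (LeafRow.row-bound leaf)
    weightedMatrix-row-bound (ofⁿ _) =
      ≤-reflexive (trans (+-identityʳ _) (trans (sum-map-const 0 (vertices G)) (*-zeroʳ (length (vertices G)))))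

    double-Wε≤ : 2 * Wε G + pendantCount G * (innerCount + diameter G)
                   ≤ pendantCount G * (totalEcc G + innerCount * diameter G)
    double-Wε≤ = begin
      2 * Wε G + k * (n + d)
        ≤⟨ +-monoˡ-≤ _ (subst (_≤ total ε) (*-comm (total ε / 2) 2) (m/n*n≤m (total ε) 2)) ⟩
      total ε + k * (n + d)
        ≡⟨ cong₂ _+_ eccMatrix-total (sym (sum-map-if-then leaf? (n + d) V)) ⟩
      total weightedMatrix + sum (map (λ v → if ℓ v then n + d else 0) V)
        ≡⟨ sum-map-+ _ _ V ⟨
      sum (map (λ v → sum (map (weightedMatrix v) V) + (if ℓ v then n + d else 0)) V)
        ≤⟨ sum-map-mono V (λ v → weightedMatrix-row-bound (proof (leaf? v))) ⟩
      sum (map (λ v → if ℓ v then E + n * d else 0) V)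
        ≡⟨ sum-map-if-then leaf? (E + n * d) V ⟩
      k * (E + n * d) ∎
      where
      open ≤-Reasoning
      V : List (Fin p)
      V = vertices G
      k n d E : ℕ
      k = pendantCount G
      n = innerCount
      d = diameter G
      E = totalEcc G


  another : ∀ {n} (c : Fin (2 + n)) → ∃[ w ] w ≢ c
  another zero = suc zero , λ ()
  another (suc _) = zero , λ ()

  third : ∀ {n} (u c : Fin (3 + n)) → ∃[ w ] w ≢ u × w ≢ c
  third zero zero = suc zero , (λ ()) , (λ ())
  third zero (suc zero) = suc (suc zero) , (λ ()) , (λ ())
  third zero (suc (suc _)) = suc zero , (λ ()) , (λ ())
  third (suc zero) zero = suc (suc zero) , (λ ()) , (λ ())
  third (suc (suc _)) zero = suc zero , (λ ()) , (λ ())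
  third (suc _) (suc _) = zero , (λ ()) , (λ ())

  record IsStarCentre {n : ℕ} (T : Graph n) (c : Fin n) : Set where
    field
      spoke : ∀ {w} → w ≢ c → adj T c w ≡ true
      rim : ∀ {u w} → u ≢ c → w ≢ c → adj T u w ≡ false

  module Star {n : ℕ} (T : Graph (suc n)) (tree : IsTree T) {c : Fin (suc n)} (is-centre : IsStarCentre T c)
              {a b : Fin (suc n)} (a≢c : a ≢ c) (b≢c : b ≢ c) (a≢b : a ≢ b) where
    open IsStarCentre is-centre
    open Reachability T
    open Metric (proj₁ tree)
    open Leaves T
    open EccentricityMatrix T tree

    private
      ε : Fin (suc n) → Fin (suc n) → ℕ
      ε = eccMatrix T

    another-rim : ∀ u → ∃[ w ] w ≢ c × w ≢ u
    another-rim u = by-cases (u ≟ᶠ a)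
      where
      by-cases : Dec (u ≡ a) → ∃[ w ] w ≢ c × w ≢ u
      by-cases (yes refl) = b , b≢c , ≢-sym a≢b
      by-cases (no u≢a) = a , a≢c , ≢-sym u≢a

    dist-centre : ∀ {w} → w ≢ c → dist T c w ≡ 1
    dist-centre w≢c = adj⇒dist≡1 (spoke w≢c)

    dist-centre≤1 : ∀ w → dist T c w ≤ 1
    dist-centre≤1 w = by-cases (w ≟ᶠ c)
      where
      by-cases : Dec (w ≡ c) → dist T c w ≤ 1
      by-cases (yes refl) = ≤-trans (≤-reflexive (dist-self c)) z≤n
      by-cases (no w≢c) = ≤-reflexive (dist-centre w≢c)

    dist≤2 : ∀ u w → dist T u w ≤ 2
    dist≤2 u w = ≤-trans (dist-triangle u c w)
      (+-mono-≤ (subst (_≤ 1) (dist-sym c u) (dist-centre≤1 u)) (dist-centre≤1 w))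

    dist-rim : ∀ {u w} → u ≢ c → w ≢ c → u ≢ w → dist T u w ≡ 2
    dist-rim {u} {w} u≢c w≢c u≢w = ≤-antisym (dist≤2 u w) (≤∧≢⇒< (≢⇒dist≥1 u≢w) 1≢dist)
      where
      1≢dist : 1 ≢ dist T u w
      1≢dist 1≡dist = contradiction (trans (sym (dist≡1⇒adj (sym 1≡dist))) (rim u≢c w≢c)) λ ()

    ecc-centre : ecc T c ≡ 1
    ecc-centre = ≤-antisym (ecc-≤ c dist-centre≤1) (subst (_≤ ecc T c) (dist-centre a≢c) (dist≤ecc c a))

    ecc-rim : ∀ {u} → u ≢ c → ecc T u ≡ 2
    ecc-rim {u} u≢c = let (w , w≢c , w≢u) = another-rim u in
      ≤-antisym (ecc-≤ u (dist≤2 u)) (subst (_≤ ecc T u) (dist-rim u≢c w≢c (≢-sym w≢u)) (dist≤ecc u w))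

    diameter≡2 : diameter T ≡ 2
    diameter≡2 = ≤-antisym (diameter-≤ dist≤2) (subst (_≤ diameter T) (ecc-rim a≢c) (ecc≤diameter a))

    rim-leaf : ∀ {u} → u ≢ c → Leaf u
    rim-leaf {u} u≢c = unique-neighbour⇒leaf (trans (adj-sym T u c) (spoke u≢c)) only-c
      where
      only-c : ∀ {y} → adj T u y ≡ true → y ≡ c
      only-c {y} uy with y ≟ᶠ c
      ... | yes y≡c = y≡c
      ... | no y≢c = contradiction (trans (sym uy) (rim u≢c y≢c)) λ ()

    centre-inner : ¬ Leaf c
    centre-inner leaf = a≢b (leaf-neighbour-unique leaf (spoke a≢c) (spoke b≢c))

    pendantCount≡n : pendantCount T ≡ n
    pendantCount≡n = begin
      pendantCount T                                     ≡⟨ *-identityʳ _ ⟨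
      pendantCount T * 1                                 ≡⟨ sum-map-if-then leaf? 1 (vertices T) ⟨
      sum (map (λ v → if ℓ v then 1 else 0) (vertices T))
        ≡⟨ sum-allFin-except c (indicator-false centre-inner) (λ u≢c → indicator-true (rim-leaf u≢c)) ⟩
      0 + n * 1                                          ≡⟨ *-identityʳ n ⟩
      n                                                  ∎
      where
      open ≡-Reasoning
      indicator-true : ∀ {v} → Leaf v → (if ℓ v then 1 else 0) ≡ 1
      indicator-true {v} leaf = cong (λ b → if b then 1 else 0) (dec-true (leaf? v) leaf)
      indicator-false : ∀ {v} → ¬ Leaf v → (if ℓ v then 1 else 0) ≡ 0
      indicator-false {v} inner = cong (λ b → if b then 1 else 0) (dec-false (leaf? v) inner)

    totalEcc≡ : totalEcc T ≡ 1 + n * 2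
    totalEcc≡ = sum-allFin-except c ecc-centre ecc-rim

    eccMatrix-centre : ∀ {w} → w ≢ c → ε c w ≡ 1
    eccMatrix-centre {w} w≢c = trans (eccMatrix-≡dist (trans (dist-centre w≢c) (sym min≡1))) (dist-centre w≢c)
      where
      min≡1 : ecc T c ⊓ ecc T w ≡ 1
      min≡1 = cong₂ _⊓_ ecc-centre (ecc-rim w≢c)

    eccMatrix-rim : ∀ {u w} → u ≢ c → w ≢ u → ε u w ≡ ε c w + 1
    eccMatrix-rim {u} {w} u≢c w≢u = by-cases (w ≟ᶠ c)
      where
      by-cases : Dec (w ≡ c) → ε u w ≡ ε c w + 1
      by-cases (yes refl) =
        trans (eccMatrix-sym u c) (trans (eccMatrix-centre u≢c) (cong (_+ 1) (sym (eccMatrix-self c))))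
      by-cases (no w≢c) =
        trans (eccMatrix-≡dist (trans dist≡2 (sym (cong₂ _⊓_ (ecc-rim u≢c) (ecc-rim w≢c)))))
              (trans dist≡2 (cong (_+ 1) (sym (eccMatrix-centre w≢c))))
        where
        dist≡2 : dist T u w ≡ 2
        dist≡2 = dist-rim u≢c w≢c (≢-sym w≢u)

    row-centre : sum (map (ε c) (vertices T)) ≡ n
    row-centre = trans (sum-allFin-except c (eccMatrix-self c) eccMatrix-centre) (*-identityʳ n)

    row-rim : ∀ {u} → u ≢ c → suc (sum (map (ε u) (vertices T))) ≡ n + n
    row-rim {u} u≢c = suc-injective (begin
      2 + sum (map (ε u) V)                     ≡⟨ +-comm 2 _ ⟩
      sum (map (ε u) V) + 2                     ≡⟨ cong (λ x → sum (map (ε u) V) + (x + 1)) (eccMatrix-centre u≢c) ⟨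
      sum (map (ε u) V) + (ε c u + 1)           ≡⟨ sum-allFin-update u (eccMatrix-rim u≢c) ⟩
      ε u u + sum (map (λ w → ε c w + 1) V)     ≡⟨ cong₂ _+_ (eccMatrix-self u) (sum-map-+ (ε c) (λ _ → 1) V) ⟩
      sum (map (ε c) V) + sum (map (λ _ → 1) V) ≡⟨ cong₂ _+_ row-centre (sum-map-const 1 V) ⟩
      n + length V * 1                          ≡⟨ cong (λ l → n + l) (trans (*-identityʳ _) (length-tabulate id)) ⟩
      n + suc n                                 ≡⟨ +-suc n n ⟩
      suc (n + n)                               ∎)
      where
      open ≡-Reasoning
      V : List (Fin (suc n))
      V = vertices T

    Wε≡ : Wε T ≡ n * n
    Wε≡ = begin
      sum (map (λ v → sum (map (ε v) (vertices T))) (vertices T)) / 2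
        ≡⟨ cong (_/ 2) (sum-allFin-except c row-centre row-rim≡row-a) ⟩
      (n + n * sum (map (ε a) (vertices T))) / 2     ≡⟨ cong (_/ 2) (*-suc n _) ⟨
      n * suc (sum (map (ε a) (vertices T))) / 2     ≡⟨ cong (λ r → n * r / 2) (row-rim a≢c) ⟩
      n * (n + n) / 2                                ≡⟨ cong (_/ 2) (arithmetic n) ⟩
      n * n * 2 / 2                                  ≡⟨ m*n/n≡m (n * n) 2 ⟩
      n * n                                          ∎
      where
      open ≡-Reasoning
      row-rim≡row-a : ∀ {u} → u ≢ c → sum (map (ε u) (vertices T)) ≡ sum (map (ε a) (vertices T))
      row-rim≡row-a u≢c = suc-injective (trans (row-rim u≢c) (sym (row-rim a≢c)))
      arithmetic : ∀ n → n * (n + n) ≡ n * n * 2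
      arithmetic = solve-∀

  module SameAdjacency {p : ℕ} {G H : Graph p} (same : ∀ u v → adj G u v ≡ adj H u v) where

    reach-cong : ∀ n u v → reach G n u v ≡ reach H n u v
    reach-cong zero u v = refl
    reach-cong (suc n) u v =
      cong₂ _∨_ (reach-cong n u v)
                (cong or (map-cong (λ w → cong₂ _∧_ (reach-cong n u w) (same w v)) (allFin p)))

    dist-cong : ∀ u v → dist G u v ≡ dist H u v
    dist-cong u v = cong sum (map-cong (λ n → cong (λ b → if b then 0 else 1) (reach-cong n u v)) (upTo p))

    ecc-cong : ∀ u → ecc G u ≡ ecc H u
    ecc-cong u = cong (foldr _⊔_ 0) (map-cong (dist-cong u) (allFin p))

    diameter-cong : diameter G ≡ diameter H
    diameter-cong = cong (foldr _⊔_ 0) (map-cong ecc-cong (allFin p))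

    totalEcc-cong : totalEcc G ≡ totalEcc H
    totalEcc-cong = cong sum (map-cong ecc-cong (allFin p))

    eccMatrix-cong : ∀ u v → eccMatrix G u v ≡ eccMatrix H u v
    eccMatrix-cong u v =
      cong₂ (λ δ m → if does (δ ≟ m) then δ else 0) (dist-cong u v) (cong₂ _⊓_ (ecc-cong u) (ecc-cong v))

    Wε-cong : Wε G ≡ Wε H
    Wε-cong = cong (λ s → sum s / 2) (map-cong (λ u → cong sum (map-cong (eccMatrix-cong u) (allFin p))) (allFin p))

    degree-cong : ∀ v → degree G v ≡ degree H v
    degree-cong v = cong length (filter-≐ (λ w → adj G v w ≟ᵇ true) (λ w → adj H v w ≟ᵇ true)
      ((λ e → trans (sym (same v _)) e) , (λ e → trans (same v _) e)) (allFin p))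

    pendantCount-cong : pendantCount G ≡ pendantCount H
    pendantCount-cong = cong length (filter-≐ (λ v → degree G v ≟ 1) (λ v → degree H v ≟ 1)
      ((λ e → trans (sym (degree-cong _)) e) , (λ e → trans (degree-cong _) e)) (allFin p))

  K₁-adjacency : ∀ (T : Graph 1) u v → adj T u v ≡ adj (star 0) u v
  K₁-adjacency T zero zero = irrefl T zero

  K₂-complete : ∀ {x y : Fin 2} → x ≢ y → adj (star 1) x y ≡ true
  K₂-complete {zero} {zero} x≢y = ⊥-elim (x≢y refl)
  K₂-complete {zero} {suc zero} _ = refl
  K₂-complete {suc zero} {zero} _ = refl
  K₂-complete {suc zero} {suc zero} x≢y = ⊥-elim (x≢y refl)

  K₂-adjacency : ∀ {T : Graph 2} → Isomorphic T (star 1) → ∀ u v → adj T u v ≡ adj (star 1) u v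
  K₂-adjacency {T} (f , preserves) u v with u ≟ᶠ v
  ... | yes refl = trans (irrefl T u) (sym (irrefl (star 1) u))
  ... | no u≢v =
    trans (sym (preserves u v)) (trans (K₂-complete (u≢v ∘ to-injective)) (sym (K₂-complete u≢v)))
    where
    open Inverse f
    to-injective : to u ≡ to v → u ≡ v
    to-injective eq = trans (sym (strictlyInverseʳ u)) (trans (cong from eq) (strictlyInverseʳ v))

  star-spoke : ∀ {q} {y : Fin (suc q)} → y ≢ zero → adj (star q) zero y ≡ true
  star-spoke {y = zero} y≢0 = ⊥-elim (y≢0 refl)
  star-spoke {y = suc _} _ = refl

  star-rim : ∀ {q} {x y : Fin (suc q)} → x ≢ zero → y ≢ zero → adj (star q) x y ≡ false
  star-rim {x = zero} x≢0 _ = ⊥-elim (x≢0 refl)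
  star-rim {x = suc _} {zero} _ y≢0 = ⊥-elim (y≢0 refl)
  star-rim {x = suc _} {suc _} _ _ = refl

  star-centre : ∀ {q} {T : Graph (suc q)} → Isomorphic T (star q) → ∃[ c ] IsStarCentre T c
  star-centre {q} {T} (f , preserves) = from zero , record { spoke = spoke ; rim = rim }
    where
    open Inverse f
    to≢zero : ∀ {w} → w ≢ from zero → to w ≢ zero
    to≢zero {w} w≢c to-w≡0 = w≢c (trans (sym (strictlyInverseʳ w)) (cong from to-w≡0))
    spoke : ∀ {w} → w ≢ from zero → adj T (from zero) w ≡ true
    spoke {w} w≢c = trans (sym (preserves (from zero) w))
      (subst (λ x → adj (star q) x (to w) ≡ true) (sym (strictlyInverseˡ zero)) (star-spoke (to≢zero w≢c)))
    rim : ∀ {u w} → u ≢ from zero → w ≢ from zero → adj T u w ≡ false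
    rim {u} {w} u≢c w≢c = trans (sym (preserves u w)) (star-rim (to≢zero u≢c) (to≢zero w≢c))

  module StarIsomorphic {m : ℕ} {T : Graph (3 + m)} (tree : IsTree T) (iso : Isomorphic T (star (2 + m))) where
    private
      c : Fin (3 + m)
      c = proj₁ (star-centre {T = T} iso)
      a : Fin (3 + m)
      a = proj₁ (another c)
      b : Fin (3 + m)
      b = proj₁ (third a c)

    open Star T tree (proj₂ (star-centre {T = T} iso)) {a} {b}
      (proj₂ (another c)) (proj₂ (proj₂ (third a c))) (≢-sym (proj₁ (proj₂ (third a c)))) public

open import Data.Nat using (ℕ; suc)
import Data.Nat as ℕ
import Data.Nat.Properties as ℕ
open import Data.Integer using (ℤ; +_; _-_; _*_; _+_; _≤_; +≤+)
open import Data.Integer.Properties using (m-n≡m⊖n; ⊖-≥; pos-+; pos-*)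
open import Data.Integer.Tactic.RingSolver using (solve-∀)

bound : ℕ → ℕ → ℕ → ℕ → ℤ
bound p k E d = (+ k) * (+ E) + (+ d) * (+ k) * ((+ p) - (+ k) - (+ 1)) - (+ k) * ((+ p) - (+ k))

+-≤-∸ : ∀ {m n o} → m ℕ.+ n ℕ.≤ o → + m ≤ + o - + n
+-≤-∸ {m} {n} {o} m+n≤o =
  subst (+ m ≤_) (sym (trans (m-n≡m⊖n o n) (⊖-≥ (ℕ.≤-trans (ℕ.m≤n+m n m) m+n≤o)))) (+≤+ (ℕ.m+n≤o⇒m≤o∸n m m+n≤o))

bound-expand : ∀ k n E d → bound (k ℕ.+ n) k E d ≡ + (k ℕ.* (E ℕ.+ n ℕ.* d)) - + (k ℕ.* (n ℕ.+ d))
bound-expand k n E d = begin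
  bound (k ℕ.+ n) k E d
    ≡⟨ cong (λ P → + k * + E + + d * + k * (P - + k - + 1) - + k * (P - + k)) (pos-+ k n) ⟩
  + k * + E + + d * + k * (+ k + + n - + k - + 1) - + k * (+ k + + n - + k)
    ≡⟨ ring (+ k) (+ n) (+ E) (+ d) ⟩
  + k * (+ E + + n * + d) - + k * (+ n + + d)
    ≡⟨ cong₂ _-_ (trans (pos-* k _) (cong (λ x → + k * x) (trans (pos-+ E _) (cong (λ x → + E + x) (pos-* n d)))))
                   (trans (pos-* k _) (cong (λ x → + k * x) (pos-+ n d))) ⟨
  + (k ℕ.* (E ℕ.+ n ℕ.* d)) - + (k ℕ.* (n ℕ.+ d)) ∎
  where
  open ≡-Reasoning
  ring : ∀ K N E D → K * E + D * K * (K + N - K - + 1) - K * (K + N - K)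
                       ≡ K * (E + N * D) - K * (N + D)
  ring = solve-∀

bound-≤ : ∀ {p k n W E d} → k ℕ.+ n ≡ p → 2 ℕ.* W ℕ.+ k ℕ.* (n ℕ.+ d) ℕ.≤ k ℕ.* (E ℕ.+ n ℕ.* d) →
  (+ 2) * (+ W) ≤ bound p k E d
bound-≤ {k = k} {n} {W} {E} {d} refl ineq =
  subst₂ _≤_ (pos-* 2 W) (sym (bound-expand k n E d)) (+-≤-∸ ineq)

bound-cong : ∀ {p k k′ E E′ d d′} → k ≡ k′ → E ≡ E′ → d ≡ d′ → bound p k E d ≡ bound p k′ E′ d′
bound-cong refl refl refl = refl

star-identity : ∀ n → (+ 2) * (+ (n ℕ.* n)) ≡ bound (suc n) n (1 ℕ.+ n ℕ.* 2) 2
star-identity n = begin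
  (+ 2) * (+ (n ℕ.* n))
    ≡⟨ cong (λ x → (+ 2) * x) (pos-* n n) ⟩
  (+ 2) * (+ n * + n)
    ≡⟨ ring (+ n) ⟩
  + n * (+ 1 + + n * + 2) + + 2 * + n * (+ 1 + + n - + n - + 1) - + n * (+ 1 + + n - + n)
    ≡⟨ cong₂ (λ E P → + n * E + + 2 * + n * (P - + n - + 1) - + n * (P - + n))
             (trans (pos-+ 1 (n ℕ.* 2)) (cong (λ x → + 1 + x) (pos-* n 2))) (pos-+ 1 n) ⟨
  bound (suc n) n (1 ℕ.+ n ℕ.* 2) 2 ∎
  where
  open ≡-Reasoning
  ring : ∀ N → (+ 2) * (N * N) ≡ N * (+ 1 + N * + 2) + + 2 * N * (+ 1 + N - N - + 1) - N * (+ 1 + N - N)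
  ring = solve-∀

star-bound : ∀ {n} {T : Graph (suc n)} →
  Wε T ≡ n ℕ.* n → pendantCount T ≡ n → totalEcc T ≡ 1 ℕ.+ n ℕ.* 2 → diameter T ≡ 2 →
  (+ 2) * (+ Wε T) ≡ bound (suc n) (pendantCount T) (totalEcc T) (diameter T)
star-bound {n} W≡ k≡ E≡ d≡ =
  trans (cong (λ W → (+ 2) * (+ W)) W≡) (trans (star-identity n) (sym (bound-cong k≡ E≡ d≡)))

same-adjacency : ∀ {q} {G H : Graph (suc q)} → (∀ u v → adj G u v ≡ adj H u v) →
  (+ 2) * (+ Wε H) ≡ bound (suc q) (pendantCount H) (totalEcc H) (diameter H) →
  (+ 2) * (+ Wε G) ≡ bound (suc q) (pendantCount G) (totalEcc G) (diameter G)
same-adjacency same eq =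
  trans (cong (λ W → (+ 2) * (+ W)) Wε-cong)
        (trans eq (sym (bound-cong pendantCount-cong totalEcc-cong diameter-cong)))
  where open SameAdjacency same

inequality : ∀ p (T : Graph p) → IsTree T → (+ 2) * (+ Wε T) ≤ bound p (pendantCount T) (totalEcc T) (diameter T)
inequality p T tree =
  bound-≤ {n = Leaves.innerCount T} {W = Wε T} (Leaves.leafCount+innerCount≡p T) (EccentricityMatrix.double-Wε≤ T tree)

equality : ∀ q (T : Graph (suc q)) → IsTree T → Isomorphic T (star q) →
  (+ 2) * (+ Wε T) ≡ bound (suc q) (pendantCount T) (totalEcc T) (diameter T)
equality 0 T _ _ = same-adjacency {G = T} {H = star 0} (K₁-adjacency T) refl
equality 1 T _ iso = same-adjacency {G = T} {H = star 1} (K₂-adjacency {T} iso) refl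
equality (suc (suc m)) T tree iso = star-bound Wε≡ pendantCount≡n totalEcc≡ diameter≡2
  where open StarIsomorphic tree iso

theorem4p7 :
    (∀ (p : ℕ) (T : Graph p) → IsTree T →
      (+ 2) * (+ Wε T)
        ≤ (+ pendantCount T) * (+ totalEcc T)
          + (+ diameter T) * (+ pendantCount T) * ((+ p) - (+ pendantCount T) - (+ 1))
          - (+ pendantCount T) * ((+ p) - (+ pendantCount T)))
    ×
    (∀ (q : ℕ) (T : Graph (suc q)) → IsTree T → Isomorphic T (star q) →
      (+ 2) * (+ Wε T)
        ≡ (+ pendantCount T) * (+ totalEcc T)
          + (+ diameter T) * (+ pendantCount T) * ((+ suc q) - (+ pendantCount T) - (+ 1))
          - (+ pendantCount T) * ((+ suc q) - (+ pendantCount T)))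
theorem4p7 = inequality , equality
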